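{- Let $n\ge 2w\ge 2$ and $i\in\{0,1,\ldots,w\}$. Let $(C_1,\ldots,C_r)$ be an equitable partition of the vertex set of the Johnson graph $J(n,w)$ with quotient matrix $A$, and let $u=(u_1,\ldots,u_r)$ be an eigenvector of $A$ with eigenvalue $\lambda_i(n,w)=(w-i)(n-w-i)-i$ such that $u_j\neq 0$ for all $j$. Then $$m_i^{ - }(n,w)\le \sum_{j:\,u_j<0}|C_j|.$$
   Context: The Johnson graph $J(n,w)$ has as vertices the $w$-element subsets of $\{1,\ldots,n\}$, two being adjacent iff their intersection has size $w-1$. For $i\in\{0,\ldots,w\}$, $V_i=V_i(n,w)$ denotes the eigenspace of the adjacency matrix of $J(n,w)$ (acting on real vectors indexed by vertices) for the eigenvalue $\lambda_i(n,w)=(w-i)(n-w-i)-i$. For a vector $v$ indexed by the vertex set $X$, let $X_+(v)=\{x:v_x>0\}$, $X_-(v)=\{x:v_x<0\}$, $X_0(v)=\{x:v_x=0\}$. Define $m_i^-(n,w)=\min\{|X_-(v)|: v\in V_i,\ X_0(v)=\emptyset\}$. A partition $(C_1,\ldots,C_r)$ of the vertex set of a graph is equitable if for all $j,l$ every vertex of $C_j$ has exactly $A_{jl}$ neighbours in $C_l$; the matrix $A=(A_{jl})$ is its quotient matrix.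
   Formalization: The eigenvector u of the quotient matrix has rational entries rather than real ones, and the vector in $V_i$ witnessing the bound on $m_i^-(n,w)$ is taken with rational entries. -}

module Defs where

open import Data.Nat as ℕ using (ℕ; zero; suc; _∸_; _≤_)
open import Data.Integer as ℤ using (ℤ)
open import Data.Rational as ℚ using (ℚ; 0ℚ; _<_)
open import Data.Rational.Properties as ℚP using ()
open import Data.Bool using (Bool; true; false)
open import Data.Fin using (Fin)
open import Data.Fin.Subset using (Subset; _∩_; ∣_∣)
open import Data.Vec using (_∷_; [])
import Data.List
open import Data.List using (List; []; _∷_; _++_; map; filter; length; foldr)
open import Data.List.Membership.Propositional using (_∈_)
open import Data.Product using (Σ; _×_; _,_; ∃)
open import Relation.Binary.PropositionalEquality using (_≡_; _≢_)
open import Relation.Nullary using (¬_)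
import Data.Fin as F
import Data.Fin.Properties as FP

allSubsets : (n : ℕ) → List (Subset n)
allSubsets zero = [] ∷ []
allSubsets (suc n) = map (true ∷_) (allSubsets n) ++ map (false ∷_) (allSubsets n)

IsVertex : (n w : ℕ) → Subset n → Set
IsVertex n w x = ∣ x ∣ ≡ w

vertices : (n w : ℕ) → List (Subset n)
vertices n w = filter (λ x → ∣ x ∣ ℕ.≟ w) (allSubsets n)

Adjacent : (n w : ℕ) → Subset n → Subset n → Set
Adjacent n w x y = ∣ x ∩ y ∣ ≡ w ∸ 1

neighbours : (n w : ℕ) → Subset n → List (Subset n)
neighbours n w x = filter (λ y → ∣ x ∩ y ∣ ℕ.≟ w ∸ 1) (vertices n w)

sumℚ : List ℚ → ℚ
sumℚ = foldr ℚ._+_ 0ℚ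

sumℕ : List ℕ → ℕ
sumℕ = foldr ℕ._+_ 0

-- eigenvalue λ_i(n,w) = (w-i)(n-w-i) - i   (for i ≤ w ≤ n-w the subtractions are exact)
eigval : (n w i : ℕ) → ℚ
eigval n w i = ((ℤ.+ ((w ∸ i) ℕ.* (n ∸ w ∸ i))) ℤ.- (ℤ.+ i)) ℚ./ 1

-- vectors indexed by vertices: functions Subset n → ℚ (values off X are irrelevant)
-- (A v)_x = sum of v over neighbours of x
adjApply : (n w : ℕ) → (Subset n → ℚ) → Subset n → ℚ
adjApply n w v x = sumℚ (map v (neighbours n w x))

InEigenspace : (n w i : ℕ) → (Subset n → ℚ) → Set
InEigenspace n w i v = ∀ x → IsVertex n w x → adjApply n w v x ≡ eigval n w i ℚ.* v x

NoZeroEntries : (n w : ℕ) → (Subset n → ℚ) → Set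
NoZeroEntries n w v = ∀ x → IsVertex n w x → v x ≢ 0ℚ

negCount : (n w : ℕ) → (Subset n → ℚ) → ℕ
negCount n w v = length (filter (λ x → v x ℚP.<? 0ℚ) (vertices n w))

-- A partition (C_1,...,C_r) of X, given by the map c : X → Fin r (C_j = c⁻¹(j)),
-- with all parts nonempty.
IsPartition : (n w r : ℕ) → (Subset n → Fin r) → Set
IsPartition n w r c = ∀ (j : Fin r) → ∃ λ x → IsVertex n w x × c x ≡ j

partSize : (n w r : ℕ) → (Subset n → Fin r) → Fin r → ℕ
partSize n w r c j = length (filter (λ x → c x FP.≟ j) (vertices n w))

IsEquitable : (n w r : ℕ) → (Subset n → Fin r) → (Fin r → Fin r → ℕ) → Set
IsEquitable n w r c A = ∀ (j l : Fin r) (x : Subset n) → IsVertex n w x → c x ≡ j →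
  length (filter (λ y → c y FP.≟ l) (neighbours n w x)) ≡ A j l

IsEigvecOf : (r : ℕ) → (Fin r → Fin r → ℕ) → (Fin r → ℚ) → ℚ → Set
IsEigvecOf r A u μ = ∀ (j : Fin r) →
  sumℚ (map (λ l → ((ℤ.+ A j l) ℚ./ 1) ℚ.* u l) (Data.List.allFin r)) ≡ μ ℚ.* u j

negPartSize : (n w r : ℕ) → (Subset n → Fin r) → (Fin r → ℚ) → ℕ
negPartSize n w r c u = sumℕ (map (partSize n w r c) (filter (λ j → u j ℚP.<? 0ℚ) (Data.List.allFin r)))

-- Lifting u along the partition gives the vector v = u ∘ c on the vertices. Equitability says
-- that each vertex of C_j has A_jl neighbours in C_l, so the neighbour sum of v at x ∈ C_j is
-- Σ_l A_jl u_l = λ_i u_j = λ_i v_x: v lies in V_i. It has no zero entries, and its negative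
-- entries are exactly the vertices of the parts C_j with u_j < 0, so the bound holds with
-- equality.
module Submission where

open import Defs
open import Data.Nat using (ℕ; _≤_; _*_)
open import Data.Fin using (Fin)
open import Data.Fin.Subset using (Subset)
open import Data.Rational using (ℚ; 0ℚ)
open import Data.Product using (Σ; _×_)
open import Relation.Binary.PropositionalEquality using (_≢_)

open import Algebra.Bundles using (CommutativeMonoid)
open import Data.Bool using (if_then_else_; true; false)
open import Data.Fin using (zero; suc) renaming (_≟_ to _≟ᶠ_)
import Data.Integer as ℤ
import Data.Integer.Properties as ℤ
open import Data.List using (List; []; _∷_; map; filter; length; foldr; tabulate; allFin)
open import Data.List.Properties using (map-tabulate)
import Data.Nat as ℕ
import Data.Nat.Properties as ℕ
open import Data.Product using (_,_)
open import Data.Rational using (1ℚ; _/_; toℚᵘ) renaming (_+_ to _+ℚ_; _*_ to _*ℚ_)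
import Data.Rational.Properties as ℚ
import Data.Rational.Unnormalised as ℚᵘ
import Data.Rational.Unnormalised.Properties as ℚᵘ
open import Function using (_∘_; id)
open import Level using (Level)
open import Relation.Binary.PropositionalEquality as ≡ using (_≡_; refl; cong; cong₂; module ≡-Reasoning)
open import Relation.Nullary using (Dec; does)
open import Relation.Unary using (Pred; Decidable)

private
  variable
    a p : Level
    A S : Set a
    r : ℕ

𝟙[_] : {P : Set p} → Dec P → ℕ
𝟙[ P? ] = if does P? then 1 else 0

length-filter : {P : Pred A p} (P? : Decidable P) (xs : List A) →
  length (filter P? xs) ≡ sumℕ (map (λ x → 𝟙[ P? x ]) xs)
length-filter P? []       = refl
length-filter P? (x ∷ xs) with does (P? x)
... | true  = cong ℕ.suc (length-filter P? xs)
... | false = length-filter P? xs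

sum-map-filter : {P : Pred A p} (P? : Decidable P) (f : A → ℕ) (xs : List A) →
  sumℕ (map f (filter P? xs)) ≡ sumℕ (map (λ x → f x * 𝟙[ P? x ]) xs)
sum-map-filter P? f []       = refl
sum-map-filter P? f (x ∷ xs) with does (P? x)
... | true  = cong₂ ℕ._+_ (≡.sym (ℕ.*-identityʳ (f x))) (sum-map-filter P? f xs)
... | false = cong₂ ℕ._+_ (≡.sym (ℕ.*-zeroʳ (f x))) (sum-map-filter P? f xs)

fibreSize : (S → Fin r) → List S → Fin r → ℕ
fibreSize c xs l = length (filter (λ x → c x ≟ᶠ l) xs)

fibreSize-∷ : (c : S → Fin r) (x : S) (xs : List S) (l : Fin r) →
  fibreSize c (x ∷ xs) l ≡ 𝟙[ c x ≟ᶠ l ] ℕ.+ fibreSize c xs l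
fibreSize-∷ c x xs l with does (c x ≟ᶠ l)
... | true  = refl
... | false = refl

module FibreSums {m ℓ} (M : CommutativeMonoid m ℓ) where

  open CommutativeMonoid M
    using (Carrier; _≈_; setoid; monoid; reflexive)
    renaming (_∙_ to _+_; ε to 0#; ∙-cong to +-cong; identityʳ to +-identityʳ; identityˡ to +-identityˡ;
              sym to ≈-sym; trans to ≈-trans)
  open import Algebra.Properties.CommutativeMonoid.Sum M public using (sum; sum-syntax; ∑-distrib-+; sum-cong-≋; sum-replicate-zero)
  open import Algebra.Properties.Monoid.Mult monoid public using (×-homo-+; ×-congˡ) renaming (_×_ to _·_)
  open import Relation.Binary.Reasoning.Setoid setoid

  sumList : List Carrier → Carrier
  sumList = foldr _+_ 0#

  sumList-tabulate : (f : Fin r → Carrier) → sumList (tabulate f) ≡ sum f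
  sumList-tabulate {ℕ.zero}  f = refl
  sumList-tabulate {ℕ.suc r} f = cong (f zero +_) (sumList-tabulate (f ∘ suc))

  sumList-allFin : (f : Fin r → Carrier) → sumList (map f (allFin r)) ≈ sum f
  sumList-allFin f = reflexive (≡.trans (cong sumList (map-tabulate id f)) (sumList-tabulate f))

  ∑-𝟙≟-· : (k : Fin r) (g : Fin r → Carrier) → ∑[ l < r ] (𝟙[ k ≟ᶠ l ] · g l) ≈ g k
  ∑-𝟙≟-· {ℕ.suc r} zero g = begin
    (g zero + 0#) + ∑[ l < r ] 0#   ≈⟨ +-cong (+-identityʳ (g zero)) (sum-replicate-zero r) ⟩
    g zero + 0#                    ≈⟨ +-identityʳ (g zero) ⟩
    g zero                         ∎
  ∑-𝟙≟-· {ℕ.suc r} (suc k) g = ≈-trans (+-identityˡ _) (∑-𝟙≟-· k (g ∘ suc))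

  sum-map-∘-fibres : (c : S → Fin r) (g : Fin r → Carrier) (xs : List S) →
    sumList (map (g ∘ c) xs) ≈ ∑[ l < r ] (fibreSize c xs l · g l)
  sum-map-∘-fibres {r = r} c g [] = ≈-sym (sum-replicate-zero r)
  sum-map-∘-fibres {r = r} c g (x ∷ xs) = begin
    g (c x) + sumList (map (g ∘ c) xs)
      ≈⟨ +-cong (≈-sym (∑-𝟙≟-· (c x) g)) (sum-map-∘-fibres c g xs) ⟩
    ∑[ l < r ] (𝟙[ c x ≟ᶠ l ] · g l) + ∑[ l < r ] (fibreSize c xs l · g l)
      ≈⟨ ≈-sym (∑-distrib-+ (λ l → 𝟙[ c x ≟ᶠ l ] · g l) (λ l → fibreSize c xs l · g l)) ⟩
    ∑[ l < r ] (𝟙[ c x ≟ᶠ l ] · g l + fibreSize c xs l · g l)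
      ≈⟨ sum-cong-≋ (λ l → ≈-sym (×-homo-+ (g l) 𝟙[ c x ≟ᶠ l ] (fibreSize c xs l))) ⟩
    ∑[ l < r ] ((𝟙[ c x ≟ᶠ l ] ℕ.+ fibreSize c xs l) · g l)
      ≈⟨ sum-cong-≋ (λ l → ×-congˡ (≡.sym (fibreSize-∷ c x xs l))) ⟩
    ∑[ l < r ] (fibreSize c (x ∷ xs) l · g l) ∎

module ℕΣ = FibreSums ℕ.+-0-commutativeMonoid

·≡* : ∀ m n → m ℕΣ.· n ≡ m * n
·≡* ℕ.zero    n = refl
·≡* (ℕ.suc m) n = cong (n ℕ.+_) (·≡* m n)

length-filter-∘ : {P : Pred (Fin r) p} (c : S → Fin r) (P? : Decidable P) (xs : List S) →
  length (filter (P? ∘ c) xs) ≡ sumℕ (map (fibreSize c xs) (filter P? (allFin r)))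
length-filter-∘ {r} c P? xs = begin
  length (filter (P? ∘ c) xs)                                   ≡⟨ length-filter (P? ∘ c) xs ⟩
  sumℕ (map (λ x → 𝟙[ P? (c x) ]) xs)                           ≡⟨ sum-map-∘-fibres c (λ l → 𝟙[ P? l ]) xs ⟩
  ∑[ l < r ] (fibreSize c xs l · 𝟙[ P? l ])                     ≡⟨ sum-cong-≋ {r} (λ l → ·≡* (fibreSize c xs l) 𝟙[ P? l ]) ⟩
  ∑[ l < r ] (fibreSize c xs l * 𝟙[ P? l ])                     ≡⟨ ≡.sym (sumList-allFin (λ l → fibreSize c xs l * 𝟙[ P? l ])) ⟩
  sumℕ (map (λ l → fibreSize c xs l * 𝟙[ P? l ]) (allFin r))    ≡⟨ ≡.sym (sum-map-filter P? (fibreSize c xs) (allFin r)) ⟩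
  sumℕ (map (fibreSize c xs) (filter P? (allFin r)))            ∎
  where
  open ℕΣ using (_·_; sum-syntax; sum-map-∘-fibres; sum-cong-≋; sumList-allFin)
  open ≡-Reasoning

module ℚΣ = FibreSums ℚ.+-0-commutativeMonoid

fromℕ : ℕ → ℚ
fromℕ n = ℤ.+ n / 1

-- ℤ.+ n / 1 normalises through gcd n 1, which does not compute for a variable n; hence the detour
-- through the unnormalised rationals.
fromℕ-suc : ∀ n → fromℕ (ℕ.suc n) ≡ 1ℚ +ℚ fromℕ n
fromℕ-suc n = ℚ.toℚᵘ-injective (begin
  toℚᵘ (fromℕ (ℕ.suc n))              ≈⟨ ℚ.toℚᵘ-fromℚᵘ (ℚᵘ.mkℚᵘ (ℤ.+ ℕ.suc n) 0) ⟩
  ℚᵘ.mkℚᵘ (ℤ.+ ℕ.suc n) 0                ≈⟨ ℚᵘ.*≡* integer-identity ⟩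
  ℚᵘ.1ℚᵘ ℚᵘ.+ ℚᵘ.mkℚᵘ (ℤ.+ n) 0          ≈⟨ ℚᵘ.+-congʳ ℚᵘ.1ℚᵘ (ℚᵘ.≃-sym (ℚ.toℚᵘ-fromℚᵘ (ℚᵘ.mkℚᵘ (ℤ.+ n) 0))) ⟩
  toℚᵘ 1ℚ ℚᵘ.+ toℚᵘ (fromℕ n)        ≈⟨ ℚᵘ.≃-sym (ℚ.toℚᵘ-homo-+ 1ℚ (fromℕ n)) ⟩
  toℚᵘ (1ℚ +ℚ fromℕ n)                 ∎)
  where
  open ℚᵘ.≃-Reasoning
  integer-identity : ℤ.+ ℕ.suc n ℤ.* ℤ.+ 1 ≡ (ℤ.+ 1 ℤ.+ ℤ.+ n ℤ.* ℤ.+ 1) ℤ.* ℤ.+ 1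
  integer-identity = ≡.trans (ℤ.*-identityʳ _)
    (≡.sym (≡.trans (ℤ.*-identityʳ _) (cong (ℤ._+_ ℤ.1ℤ) (ℤ.*-identityʳ (ℤ.+ n)))))

·≡fromℕ* : ∀ n q → n ℚΣ.· q ≡ fromℕ n *ℚ q
·≡fromℕ* ℕ.zero    q = ≡.sym (ℚ.*-zeroˡ q)
·≡fromℕ* (ℕ.suc n) q = begin
  q +ℚ n ℚΣ.· q               ≡⟨ cong₂ _+ℚ_ (≡.sym (ℚ.*-identityˡ q)) (·≡fromℕ* n q) ⟩
  1ℚ *ℚ q +ℚ fromℕ n *ℚ q     ≡⟨ ≡.sym (ℚ.*-distribʳ-+ q 1ℚ (fromℕ n)) ⟩
  (1ℚ +ℚ fromℕ n) *ℚ q        ≡⟨ cong (_*ℚ q) (≡.sym (fromℕ-suc n)) ⟩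
  fromℕ (ℕ.suc n) *ℚ q        ∎
  where open ≡-Reasoning

lift-eigenvector : ∀ {n w r c A u μ} → IsEquitable n w r c A → IsEigvecOf r A u μ →
  ∀ x → IsVertex n w x → adjApply n w (u ∘ c) x ≡ μ *ℚ u (c x)
lift-eigenvector {n} {w} {r} {c} {A} {u} {μ} equitable eigen x x∈X = begin
  sumℚ (map (u ∘ c) (neighbours n w x))                     ≡⟨ sum-map-∘-fibres c u (neighbours n w x) ⟩
  ∑[ l < r ] (fibreSize c (neighbours n w x) l · u l)       ≡⟨ sum-cong-≋ {r} fibre-weight ⟩
  ∑[ l < r ] (fromℕ (A (c x) l) *ℚ u l)                     ≡⟨ ≡.sym (sumList-allFin (λ l → fromℕ (A (c x) l) *ℚ u l)) ⟩
  sumℚ (map (λ l → fromℕ (A (c x) l) *ℚ u l) (allFin r))   ≡⟨ eigen (c x) ⟩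
  μ *ℚ u (c x)                                             ∎
  where
  open ℚΣ using (_·_; sum-syntax; sum-map-∘-fibres; sum-cong-≋; sumList-allFin)
  open ≡-Reasoning
  fibre-weight : ∀ l → fibreSize c (neighbours n w x) l · u l ≡ fromℕ (A (c x) l) *ℚ u l
  fibre-weight l = ≡.trans (·≡fromℕ* (fibreSize c (neighbours n w x) l) (u l))
    (cong (λ k → fromℕ k *ℚ u l) (equitable (c x) l x x∈X refl))

proposition1 : (n w i : ℕ) → 1 ≤ w → 2 * w ≤ n → i ≤ w →
    (r : ℕ) (c : Subset n → Fin r) (A : Fin r → Fin r → ℕ) →
    IsPartition n w r c → IsEquitable n w r c A →
    (u : Fin r → ℚ) → IsEigvecOf r A u (eigval n w i) → (∀ j → u j ≢ 0ℚ) →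
    Σ (Subset n → ℚ) λ v → InEigenspace n w i v × NoZeroEntries n w v ×
    negCount n w v ≤ negPartSize n w r c u
proposition1 n w i _ _ _ r c A _ equitable u eigen nonzero =
  u ∘ c ,
  lift-eigenvector {μ = eigval n w i} equitable eigen ,
  (λ x _ → nonzero (c x)) ,
  ℕ.≤-reflexive (length-filter-∘ c (λ l → u l ℚ.<? 0ℚ) (vertices n w))
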